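{- Let $n\ge 2$ and let $Q_{4n}=\langle x,y: x^n=y^2, x^{2n}=y^4=e, y^{ -1}xy=x^{ -1}\rangle$ be the generalized quaternion group of order $4n$. Then $\operatorname{sdim}(\mathcal{P}_E(Q_{4n}))=4n-2$.
   Context: The enhanced power graph $\mathcal{P}_E(G)$ of a finite group $G$ has vertex set $G$, two distinct vertices $x,y$ adjacent iff $\langle x,y\rangle$ is cyclic. For a graph $\Gamma$ and vertices $x,y,z$, $z$ strongly resolves $x$ and $y$ if there is a shortest path from $z$ to $x$ containing $y$ or a shortest path from $z$ to $y$ containing $x$; a strong resolving set is a vertex set $S$ such that every pair of distinct vertices is strongly resolved by some vertex of $S$; $\operatorname{sdim}(\Gamma)$ is the minimum size of a strong resolving set. -}

module Defs where

open import Data.Nat using (ℕ; zero; suc; _+_; _*_; _∸_; _≤_; _%_)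
open import Data.Nat.DivMod using (m%n<n)
open import Data.Fin using (Fin; toℕ; fromℕ<)
open import Data.Bool using (Bool; true; false)
open import Data.Product using (_×_; _,_; ∃; ∃-syntax; Σ)
open import Data.List using (List; []; _∷_; length)
open import Data.List.Membership.Propositional using (_∈_)
open import Data.List.Relation.Unary.Unique.Propositional using (Unique)
open import Data.Sum using (_⊎_)
open import Relation.Binary.PropositionalEquality using (_≡_; _≢_)

reduce : ∀ {N} → Fin N → ℕ → Fin N
reduce {suc k} _ m = fromℕ< (m%n<n m (suc k))

addMod : ∀ {N} → Fin N → Fin N → Fin N
addMod i j = reduce i (toℕ i + toℕ j)

subMod : ∀ {N} → Fin N → Fin N → Fin N
subMod {N} i j = reduce i (toℕ i + (N ∸ toℕ j))

-- The generalized quaternion group Q_{4n}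
-- (i , false) represents x^i, (i , true) represents x^i y, with i mod 2n.
-- Relations: x^{2n} = e, y^2 = x^n, y^{-1} x y = x^{-1} (so y x^j = x^{-j} y).

Q : ℕ → Set
Q n = Fin (2 * n) × Bool

shiftN : ∀ n → Fin (2 * n) → Fin (2 * n)
shiftN n i = reduce i (toℕ i + n)

mulQ : ∀ n → Q n → Q n → Q n
mulQ n (i , false) (j , false) = addMod i j , false
mulQ n (i , false) (j , true)  = addMod i j , true
mulQ n (i , true)  (j , false) = subMod i j , true
mulQ n (i , true)  (j , true)  = shiftN n (subMod i j) , false

invQ : ∀ n → Q n → Q n
invQ n (i , false) = subMod (subMod i i) i , false
invQ n (i , true)  = shiftN n i , true

data Gen {G : Set} (mul : G → G → G) (inv : G → G) (gs : List G) : G → Set where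
  gen-base : ∀ {g} → g ∈ gs → Gen mul inv gs g
  gen-mul  : ∀ {a b} → Gen mul inv gs a → Gen mul inv gs b → Gen mul inv gs (mul a b)
  gen-inv  : ∀ {a} → Gen mul inv gs a → Gen mul inv gs (inv a)

-- ⟨a , b⟩ is cyclic: some g ∈ ⟨a,b⟩ generates it, i.e. ⟨a,b⟩ ⊆ ⟨g⟩
-- (⟨g⟩ ⊆ ⟨a,b⟩ follows from g ∈ ⟨a,b⟩).
CyclicPair : {G : Set} (mul : G → G → G) (inv : G → G) → G → G → Set
CyclicPair mul inv a b =
  ∃[ g ] (Gen mul inv (a ∷ b ∷ []) g
         × (∀ h → Gen mul inv (a ∷ b ∷ []) h → Gen mul inv (g ∷ []) h))

EPGAdj : {G : Set} (mul : G → G → G) (inv : G → G) → G → G → Set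
EPGAdj mul inv a b = a ≢ b × CyclicPair mul inv a b

module _ {V : Set} (Adj : V → V → Set) where

  data Walk : V → V → ℕ → Set where
    nil  : ∀ {v} → Walk v v 0
    cons : ∀ {u w v k} → Adj u w → Walk w v k → Walk u v (suc k)

  data OnWalk (x : V) : ∀ {u v k} → Walk u v k → Set where
    here  : ∀ {v k} {p : Walk x v k} → OnWalk x p
    there : ∀ {u w v k} {e : Adj u w} {p : Walk w v k} → OnWalk x p → OnWalk x (cons e p)

  -- a walk of minimum length (necessarily a path): a shortest path
  IsShortest : ∀ {u v k} → Walk u v k → Set
  IsShortest {u} {v} {k} _ = ∀ k' → Walk u v k' → k ≤ k'

  ShortestThrough : V → V → V → Set
  ShortestThrough z x y = ∃[ k ] Σ (Walk z x k) (λ p → IsShortest p × OnWalk y p)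

  StronglyResolves : V → V → V → Set
  StronglyResolves z x y = ShortestThrough z x y ⊎ ShortestThrough z y x

  StrongResolvingSet : List V → Set
  StrongResolvingSet S =
    ∀ x y → x ≢ y → ∃[ z ] (z ∈ S × StronglyResolves z x y)

  SDimIs : ℕ → Set
  SDimIs d =
    (∃[ S ] (Unique S × length S ≡ d × StrongResolvingSet S))
    × (∀ S → Unique S → StrongResolvingSet S → d ≤ length S)

module Submission where

-- In Q_{4n} two elements are adjacent iff they lie in a common maximal cyclic subgroup, i.e. in ⟨x⟩ or
-- in some ⟨x^k y⟩ = {1, x^n, x^k y, x^(k+n) y}. So the central elements 1 and x^n are adjacent to every
-- vertex, and every other vertex is simplicial: its neighbourhood lies in its unique maximal cyclic
-- subgroup, a clique. Neither kind of vertex is ever interior to a shortest path (paths to a universal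
-- vertex have length ≤ 1, and a simplicial vertex can be bypassed), so two vertices of the same kind are
-- strongly resolved only by themselves: a strong resolving set misses at most one vertex of each kind,
-- whence sdim ≥ 4n − 2. Conversely all vertices but 1 and y resolve strongly, because for n ≥ 2 the
-- path x − 1 − y is a shortest one.

open import Defs
open import Data.Bool using (true; false)
import Data.Bool.Properties as Bool
open import Data.Empty using (⊥; ⊥-elim)
open import Data.Fin using (Fin; toℕ) renaming (zero to fzero; suc to fsuc)
import Data.Fin.Properties as Fin
open import Data.List using (List; []; _∷_; length; map; _++_; filter; allFin)
open import Data.List.Membership.Propositional using (_∈_; _─_)
open import Data.List.Membership.Propositional.Properties using (∈-map⁺; ∈-map⁻; ∈-++⁺ˡ; ∈-++⁺ʳ; ∈-filter⁻; ∈-allFin)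
import Data.List.Membership.DecPropositional as DecMembership
open import Data.List.Properties using (length-map; length-++; length-tabulate; length-removeAt′)
open import Data.List.Relation.Unary.All as All using (_∷_)
open import Data.List.Relation.Unary.AllPairs using (_∷_)
open import Data.List.Relation.Unary.Any using (here; there; index)
open import Data.List.Relation.Unary.Unique.Propositional using (Unique)
open import Data.List.Relation.Unary.Unique.Propositional.Properties using (map⁺; ++⁺; allFin⁺; filter⁺)
import Data.Nat as ℕ
open import Data.Nat using (ℕ; zero; suc; _+_; _*_; _∸_; _≤_; _<_; _%_; _/_; z≤n; s≤s; NonZero)
open import Data.Nat.Divisibility using (_∣_; divides; ∣-refl)
open import Data.Nat.DivMod
open import Data.Nat.GCD using (gcd; gcd-GCD; gcd[m,n]∣m; gcd[m,n]∣n; module Bézout)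
open import Data.Nat.Properties hiding (_≟_)
open import Data.Nat.Tactic.RingSolver using (solve-∀)
open import Data.Product using (_×_; _,_; ∃-syntax; Σ; proj₁; proj₂)
open import Data.Product.Properties using (≡-dec)
open import Data.Sum using (_⊎_; inj₁; inj₂)
import Data.Sum as Sum
open import Data.Unit using (⊤; tt)
open import Function using (_∘_)
open import Relation.Binary.Definitions using (DecidableEquality)
open import Relation.Binary.PropositionalEquality
open import Relation.Nullary using (¬_; Dec; yes; no; map′)
open import Relation.Unary using (Decidable)
open import Relation.Unary.Properties using (∁?)

module _ {A : Set} where

  ∈-─ : ∀ {x y : A} {xs} (x∈xs : x ∈ xs) → y ∈ xs → y ≢ x → y ∈ xs ─ x∈xs
  ∈-─ (here refl) (here refl) y≢x = ⊥-elim (y≢x refl)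
  ∈-─ (here refl) (there y∈xs) _ = y∈xs
  ∈-─ (there _) (here refl) _ = here refl
  ∈-─ (there x∈xs) (there y∈xs) y≢x = there (∈-─ x∈xs y∈xs y≢x)

  Unique-⊆⇒length≤ : ∀ {xs ys : List A} → Unique xs → (∀ {x} → x ∈ xs → x ∈ ys) →
                     length xs ≤ length ys
  Unique-⊆⇒length≤ {[]} _ _ = z≤n
  Unique-⊆⇒length≤ {x ∷ xs} {ys} (x∉xs ∷ xs!) xs⊆ys = begin
      suc (length xs)          ≤⟨ s≤s (Unique-⊆⇒length≤ xs! xs⊆ys─x) ⟩
      suc (length (ys ─ x∈ys)) ≡⟨ length-removeAt′ ys (index x∈ys) ⟨
      length ys                ∎
    where
      open ≤-Reasoning
      x∈ys : x ∈ ys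
      x∈ys = xs⊆ys (here refl)
      xs⊆ys─x : ∀ {y} → y ∈ xs → y ∈ ys ─ x∈ys
      xs⊆ys─x y∈xs = ∈-─ x∈ys (xs⊆ys (there y∈xs)) (λ { refl → All.lookup x∉xs y∈xs refl })

  length≤filter+filter∁ : ∀ {P : A → Set} (P? : Decidable P) xs →
                          length xs ≤ length (filter P? xs) + length (filter (∁? P?) xs)
  length≤filter+filter∁ P? [] = z≤n
  length≤filter+filter∁ P? (x ∷ xs) with P? x
  ... | yes _ = s≤s (length≤filter+filter∁ P? xs)
  ... | no _  = ≤-trans (s≤s (length≤filter+filter∁ P? xs)) (≤-reflexive (sym (+-suc _ _)))

  SameKind : (A → Set) → A → A → Set
  SameKind P a b = (P a × P b) ⊎ (¬ P a × ¬ P b)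

  sameKind-two-of-three : ∀ {P : A → Set} → Decidable P → ∀ a b c →
                          SameKind P a b ⊎ SameKind P a c ⊎ SameKind P b c
  sameKind-two-of-three P? a b c with P? a | P? b | P? c
  ... | yes pa | yes pb | _      = inj₁ (inj₁ (pa , pb))
  ... | no ¬pa | no ¬pb | _      = inj₁ (inj₂ (¬pa , ¬pb))
  ... | yes pa | no ¬pb | yes pc = inj₂ (inj₁ (inj₁ (pa , pc)))
  ... | yes _  | no ¬pb | no ¬pc = inj₂ (inj₂ (inj₂ (¬pb , ¬pc)))
  ... | no _   | yes pb | yes pc = inj₂ (inj₂ (inj₁ (pb , pc)))
  ... | no ¬pa | yes _  | no ¬pc = inj₂ (inj₁ (inj₂ (¬pa , ¬pc)))

  length≤2-if-kinds-differ : ∀ {P : A → Set} → Decidable P → ∀ {xs} → Unique xs →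
    (∀ {a b} → a ∈ xs → b ∈ xs → a ≢ b → ¬ SameKind P a b) → length xs ≤ 2
  length≤2-if-kinds-differ P? {[]} _ _ = z≤n
  length≤2-if-kinds-differ P? {_ ∷ []} _ _ = s≤s z≤n
  length≤2-if-kinds-differ P? {_ ∷ _ ∷ []} _ _ = s≤s (s≤s z≤n)
  length≤2-if-kinds-differ P? {a ∷ b ∷ c ∷ _} ((a≢b ∷ a≢c ∷ _) ∷ (b≢c ∷ _) ∷ _) differ
    with sameKind-two-of-three P? a b c
  ... | inj₁ ab        = ⊥-elim (differ (here refl) (there (here refl)) a≢b ab)
  ... | inj₂ (inj₁ ac) = ⊥-elim (differ (here refl) (there (there (here refl))) a≢c ac)
  ... | inj₂ (inj₂ bc) = ⊥-elim (differ (there (here refl)) (there (there (here refl))) b≢c bc)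

module _ {G : Set} {mul : G → G → G} {inv : G → G} where

  Gen-closed : ∀ {gs} (P : G → Set) → (∀ {a b} → P a → P b → P (mul a b)) →
               (∀ {a} → P a → P (inv a)) → (∀ {g} → g ∈ gs → P g) →
               ∀ {h} → Gen mul inv gs h → P h
  Gen-closed P P-mul P-inv P-gs (gen-base g∈gs) = P-gs g∈gs
  Gen-closed P P-mul P-inv P-gs (gen-mul a b) =
    P-mul (Gen-closed P P-mul P-inv P-gs a) (Gen-closed P P-mul P-inv P-gs b)
  Gen-closed P P-mul P-inv P-gs (gen-inv a) = P-inv (Gen-closed P P-mul P-inv P-gs a)

  Gen-⊆ : ∀ {gs hs} → (∀ {g} → g ∈ gs → Gen mul inv hs g) → ∀ {h} → Gen mul inv gs h → Gen mul inv hs h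
  Gen-⊆ = Gen-closed (Gen mul inv _) gen-mul gen-inv

  cyclicPair-intro : ∀ {a b g} → Gen mul inv (a ∷ b ∷ []) g →
                     Gen mul inv (g ∷ []) a → Gen mul inv (g ∷ []) b → CyclicPair mul inv a b
  cyclicPair-intro {a} {b} {g} g∈⟨a,b⟩ a∈⟨g⟩ b∈⟨g⟩ = g , g∈⟨a,b⟩ , λ _ → Gen-⊆ generators
    where
      generators : ∀ {h} → h ∈ a ∷ b ∷ [] → Gen mul inv (g ∷ []) h
      generators (here refl)         = a∈⟨g⟩
      generators (there (here refl)) = b∈⟨g⟩

  EPGAdj-sym : ∀ {a b} → EPGAdj mul inv a b → EPGAdj mul inv b a
  EPGAdj-sym {a} {b} (a≢b , g , g∈⟨a,b⟩ , ⟨a,b⟩⊆⟨g⟩) =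
    a≢b ∘ sym , cyclicPair-intro (Gen-⊆ swap g∈⟨a,b⟩) (in⟨g⟩ (there (here refl))) (in⟨g⟩ (here refl))
    where
      in⟨g⟩ : ∀ {h} → h ∈ a ∷ b ∷ [] → Gen mul inv (g ∷ []) h
      in⟨g⟩ h∈ = ⟨a,b⟩⊆⟨g⟩ _ (gen-base h∈)
      swap : ∀ {h} → h ∈ a ∷ b ∷ [] → Gen mul inv (b ∷ a ∷ []) h
      swap (here refl)         = gen-base (there (here refl))
      swap (there (here refl)) = gen-base (here refl)

module StrongResolution {V : Set} (Adj : V → V → Set) (_≟_ : DecidableEquality V) where

  Universal : V → Set
  Universal t = ∀ z → z ≢ t → Adj z t

  Simplicial : V → Set
  Simplicial v = ∀ {a b} → Adj a v → Adj v b → a ≢ b → Adj a b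

  Shortest : V → V → Set
  Shortest u v = ∃[ k ] Σ (Walk Adj u v k) (IsShortest Adj)

  interior⇒2≤length : ∀ {v z u k} (p : Walk Adj z u k) → OnWalk Adj v p → v ≢ z → v ≢ u → 2 ≤ k
  interior⇒2≤length p here v≢z _ = ⊥-elim (v≢z refl)
  interior⇒2≤length (cons _ nil) (there here) _ v≢u = ⊥-elim (v≢u refl)
  interior⇒2≤length (cons _ (cons _ _)) (there _) _ _ = s≤s (s≤s z≤n)

  -- the neighbours of v on both sides are adjacent, or equal, so v can be cut out
  bypass : ∀ {v} → Simplicial v → ∀ {z u k} (p : Walk Adj z u k) → OnWalk Adj v p → v ≢ z → v ≢ u →
           ∃[ k′ ] (k′ < k × Walk Adj z u k′)
  bypass sv p here v≢z _ = ⊥-elim (v≢z refl)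
  bypass {v} sv (cons {w = w} e p) (there on) _ v≢u with v ≟ w
  bypass sv (cons e p) (there on) _ v≢u | no v≢w with bypass sv p on v≢w v≢u
  ... | k′ , k′<k , p′ = suc k′ , s≤s k′<k , cons e p′
  bypass sv (cons e nil) (there on) _ v≢u | yes refl = ⊥-elim (v≢u refl)
  bypass sv (cons {u = z} e (cons {w = w′} {k = k} f p)) (there on) _ _ | yes refl with z ≟ w′
  ... | yes refl = k , ≤-trans (n<1+n k) (n≤1+n (suc k)) , p
  ... | no z≢w′  = suc k , ≤-refl , cons (sv e f z≢w′) p

  simplicial-not-interior : ∀ {v} → Simplicial v → ∀ {z u k} (p : Walk Adj z u k) → IsShortest Adj p →
                            OnWalk Adj v p → v ≢ z → v ≢ u → ⊥
  simplicial-not-interior sv p p-shortest on v≢z v≢u with bypass sv p on v≢z v≢u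
  ... | k′ , k′<k , p′ = <⇒≱ k′<k (p-shortest k′ p′)

  universal-end-no-interior : ∀ {t} → Universal t → ∀ {v z k} (p : Walk Adj z t k) → IsShortest Adj p →
                              OnWalk Adj v p → v ≢ z → v ≢ t → ⊥
  universal-end-no-interior {t} ut {z = z} p p-shortest on v≢z v≢t with z ≟ t
  ... | yes refl = <⇒≱ (interior⇒2≤length p on v≢z v≢t) (≤-trans (p-shortest 0 nil) z≤n)
  ... | no z≢t   = <⇒≱ (interior⇒2≤length p on v≢z v≢t) (p-shortest 1 (cons (ut z z≢t) nil))

  one-step-shortest : ∀ {u v} → u ≢ v → Adj u v → Shortest u v
  one-step-shortest {u} {v} u≢v u~v = 1 , cons u~v nil , at-least-one
    where
      at-least-one : ∀ k → Walk Adj u v k → 1 ≤ k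
      at-least-one zero nil = ⊥-elim (u≢v refl)
      at-least-one (suc _) _ = s≤s z≤n

  two-step-shortest : ∀ {u c v} → u ≢ v → ¬ Adj u v → Adj u c → Adj c v → ShortestThrough Adj u v c
  two-step-shortest {u} {c} {v} u≢v u≁v u~c c~v = 2 , cons u~c (cons c~v nil) , at-least-two , there here
    where
      at-least-two : ∀ k → Walk Adj u v k → 2 ≤ k
      at-least-two zero nil = ⊥-elim (u≢v refl)
      at-least-two (suc zero) (cons u~v nil) = ⊥-elim (u≁v u~v)
      at-least-two (suc (suc _)) _ = s≤s (s≤s z≤n)

  shortest-via-universal : (∀ u v → Dec (Adj u v)) → (∀ {u v} → Adj u v → Adj v u) →
                           ∀ {c} → Universal c → ∀ {u v} → u ≢ v → Shortest u v
  shortest-via-universal Adj? Adj-sym {c} uc {u} {v} u≢v with Adj? u v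
  ... | yes u~v = one-step-shortest u≢v u~v
  ... | no u≁v  = let k , p , p-shortest , _ = two-step-shortest u≢v u≁v u~c c~v in k , p , p-shortest
    where
      c~v : Adj c v
      c~v = Adj-sym (uc v λ { refl → u≁v (uc u u≢v) })
      u~c : Adj u c
      u~c = uc u λ { refl → u≁v c~v }

  shortest-through-start : ∀ {u v} → Shortest u v → ShortestThrough Adj u v u
  shortest-through-start (k , p , p-shortest) = k , p , p-shortest , here

  all-but-two-resolving : (∀ {u v} → u ≢ v → Shortest u v) → ∀ {S a b z} →
                          (∀ x → x ∈ S ⊎ x ≡ a ⊎ x ≡ b) → z ∈ S → StronglyResolves Adj z a b →
                          StrongResolvingSet Adj S
  all-but-two-resolving shortest covers z∈S z-resolves x y x≢y with covers x | covers y
  ... | inj₁ x∈S | _ = x , x∈S , inj₂ (shortest-through-start (shortest x≢y))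
  ... | _ | inj₁ y∈S = y , y∈S , inj₁ (shortest-through-start (shortest (x≢y ∘ sym)))
  ... | inj₂ (inj₁ refl) | inj₂ (inj₁ refl) = ⊥-elim (x≢y refl)
  ... | inj₂ (inj₂ refl) | inj₂ (inj₂ refl) = ⊥-elim (x≢y refl)
  ... | inj₂ (inj₁ refl) | inj₂ (inj₂ refl) = _ , z∈S , z-resolves
  ... | inj₂ (inj₂ refl) | inj₂ (inj₁ refl) = _ , z∈S , Sum.swap z-resolves

  module _ {P : V → Set} (P? : Decidable P) (universal : ∀ {v} → P v → Universal v)
           (simplicial : ∀ {v} → ¬ P v → Simplicial v) where

    sameKind-unresolved : ∀ {a b z} → a ≢ z → b ≢ z → a ≢ b → SameKind P a b →
                          ¬ StronglyResolves Adj z a b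
    sameKind-unresolved _ b≢z a≢b (inj₁ (pa , _)) (inj₁ (_ , p , p-shortest , b∈p)) =
      universal-end-no-interior (universal pa) p p-shortest b∈p b≢z (a≢b ∘ sym)
    sameKind-unresolved a≢z _ a≢b (inj₁ (_ , pb)) (inj₂ (_ , p , p-shortest , a∈p)) =
      universal-end-no-interior (universal pb) p p-shortest a∈p a≢z a≢b
    sameKind-unresolved _ b≢z a≢b (inj₂ (_ , ¬pb)) (inj₁ (_ , p , p-shortest , b∈p)) =
      simplicial-not-interior (simplicial ¬pb) p p-shortest b∈p b≢z (a≢b ∘ sym)
    sameKind-unresolved a≢z _ a≢b (inj₂ (¬pa , _)) (inj₂ (_ , p , p-shortest , a∈p)) =
      simplicial-not-interior (simplicial ¬pa) p p-shortest a∈p a≢z a≢b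

    resolving-set-misses-≤2 : ∀ {S} → StrongResolvingSet Adj S → ∀ {L} → Unique L →
                              length L ≤ length S + 2
    resolving-set-misses-≤2 {S} S-resolving {L} L! = begin
        length L                                      ≤⟨ length≤filter+filter∁ (_∈? S) L ⟩
        length (filter (_∈? S) L) + length outside-S  ≤⟨ +-mono-≤ inside-S≤ outside-S≤2 ⟩
        length S + 2                                  ∎
      where
        open ≤-Reasoning
        open DecMembership _≟_ using (_∈?_)
        outside-S : List V
        outside-S = filter (∁? (_∈? S)) L
        inside-S≤ : length (filter (_∈? S) L) ≤ length S
        inside-S≤ = Unique-⊆⇒length≤ (filter⁺ (_∈? S) L!) (proj₂ ∘ ∈-filter⁻ (_∈? S) {xs = L})
        ∉S : ∀ {a} → a ∈ outside-S → ¬ a ∈ S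
        ∉S = proj₂ ∘ ∈-filter⁻ (∁? (_∈? S)) {xs = L}
        ∉S⇒≢ : ∀ {a z} → a ∈ outside-S → z ∈ S → a ≢ z
        ∉S⇒≢ a∈ z∈S refl = ∉S a∈ z∈S
        outside-S≤2 : length outside-S ≤ 2
        outside-S≤2 = length≤2-if-kinds-differ P? (filter⁺ (∁? (_∈? S)) L!) λ {a} {b} a∈ b∈ a≢b same →
          let z , z∈S , z-resolves = S-resolving a b a≢b in
          sameKind-unresolved (∉S⇒≢ a∈ z∈S) (∉S⇒≢ b∈ z∈S) a≢b same z-resolves

toℕ-reduce : ∀ {K} (i : Fin (suc K)) a → toℕ (reduce i a) ≡ a % suc K
toℕ-reduce {K} _ a = Fin.toℕ-fromℕ< (m%n<n a (suc K))

%-cong-+ : ∀ d .{{_ : NonZero d}} a a′ b b′ → a % d ≡ a′ % d → b % d ≡ b′ % d →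
           (a + b) % d ≡ (a′ + b′) % d
%-cong-+ d a a′ b b′ a≡a′ b≡b′ = begin
    (a + b) % d           ≡⟨ %-distribˡ-+ a b d ⟩
    (a % d + b % d) % d   ≡⟨ cong₂ (λ s t → (s + t) % d) a≡a′ b≡b′ ⟩
    (a′ % d + b′ % d) % d ≡⟨ %-distribˡ-+ a′ b′ d ⟨
    (a′ + b′) % d         ∎
  where open ≡-Reasoning

%-+∸ : ∀ d .{{_ : NonZero d}} {M} → d ∣ M → ∀ a b {j} → j ≤ M → a % d ≡ (b + j) % d →
       (a + (M ∸ j)) % d ≡ b % d
%-+∸ d {M} d∣M a b {j} j≤M a≡b+j = begin
    (a + (M ∸ j)) % d     ≡⟨ %-cong-+ d a (b + j) (M ∸ j) (M ∸ j) a≡b+j refl ⟩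
    (b + j + (M ∸ j)) % d ≡⟨ cong (_% d) (trans (+-assoc b j (M ∸ j)) (cong (b +_) (m+[n∸m]≡n j≤M))) ⟩
    (b + M) % d           ≡⟨ %-remove-+ʳ b d∣M ⟩
    b % d                 ∎
  where open ≡-Reasoning

module QuaternionGraph (m : ℕ) where

  n : ℕ
  n = suc m

  N : ℕ
  N = 2 * n

  N≡n+n : N ≡ n + n
  N≡n+n = cong (n +_) (+-identityʳ n)

  n∣N : n ∣ N
  n∣N = divides 2 refl

  n<N : n < N
  n<N = m<m+n n (s≤s z≤n)

  <N⇒≡%n⊎≡%n+n : ∀ {a} → a < N → a ≡ a % n ⊎ a ≡ a % n + n
  <N⇒≡%n⊎≡%n+n {a} a<N with a / n | m<n*o⇒m/o<n {a} {2} {n} a<N | m≡m%n+[m/n]*n a n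
  ... | 0           | _              | a≡ = inj₁ (trans a≡ (+-identityʳ (a % n)))
  ... | 1           | _              | a≡ = inj₂ (trans a≡ (cong (a % n +_) (+-identityʳ n)))
  ... | suc (suc _) | s≤s (s≤s ()) | _

  -- the two lifts of a residue mod n to [0, N) differ by n
  +n%N≡other-lift : ∀ {k l} → k < N → l < N → k % n ≡ l % n → k ≢ l → (k + n) % N ≡ l
  +n%N≡other-lift {k} {l} k<N l<N k≡l[n] k≢l with <N⇒≡%n⊎≡%n+n k<N | <N⇒≡%n⊎≡%n+n l<N
  ... | inj₁ k≡ | inj₁ l≡ = ⊥-elim (k≢l (trans k≡ (trans k≡l[n] (sym l≡))))
  ... | inj₂ k≡ | inj₂ l≡ = ⊥-elim (k≢l (trans k≡ (trans (cong (_+ n) k≡l[n]) (sym l≡))))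
  ... | inj₁ k≡ | inj₂ l≡ = begin
      (k + n) % N     ≡⟨ m<n⇒m%n≡m k+n<N ⟩
      k + n           ≡⟨ cong (_+ n) (trans k≡ k≡l[n]) ⟩
      l % n + n       ≡⟨ l≡ ⟨
      l               ∎
    where
      open ≡-Reasoning
      k+n<N : k + n < N
      k+n<N = subst (k + n <_) (sym N≡n+n) (+-monoˡ-< n (subst (_< n) (sym k≡) (m%n<n k n)))
  ... | inj₂ k≡ | inj₁ l≡ = begin
      (k + n) % N     ≡⟨ cong (λ t → (t + n) % N) k≡ ⟩
      (k % n + n + n) % N ≡⟨ cong (_% N) (trans (+-assoc (k % n) n n) (cong (k % n +_) (sym N≡n+n))) ⟩
      (k % n + N) % N ≡⟨ [m+n]%n≡m%n (k % n) N ⟩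
      k % n % N       ≡⟨ m<n⇒m%n≡m (<-trans (m%n<n k n) n<N) ⟩
      k % n           ≡⟨ trans k≡l[n] (sym l≡) ⟩
      l               ∎
    where open ≡-Reasoning

  G : Set
  G = Q n

  infixl 7 _·_
  _·_ : G → G → G
  _·_ = mulQ n

  infix 8 _⁻¹
  _⁻¹ : G → G
  _⁻¹ = invQ n

  ⟨_⟩ : List G → G → Set
  ⟨_⟩ = Gen _·_ _⁻¹

  Adj : G → G → Set
  Adj = EPGAdj _·_ _⁻¹

  _≟_ : DecidableEquality G
  _≟_ = ≡-dec Fin._≟_ Bool._≟_

  ≡-on-index : ∀ {i j : Fin N} {b} → toℕ i ≡ toℕ j → _≡_ {A = G} (i , b) (j , b)
  ≡-on-index {b = b} i≡j = cong (_, b) (Fin.toℕ-injective i≡j)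

  toℕ≤N : ∀ (i : Fin N) → toℕ i ≤ N
  toℕ≤N i = <⇒≤ (Fin.toℕ<n i)

  toℕ-reduce-%n : ∀ (i : Fin N) a → toℕ (reduce i a) % n ≡ a % n
  toℕ-reduce-%n i a = trans (cong (_% n) (toℕ-reduce i a)) (m∣n⇒o%n%m≡o%m n N a n∣N)

  toℕ-subMod-%n : ∀ (i j : Fin N) → toℕ i % n ≡ toℕ j % n → toℕ (subMod i j) % n ≡ 0
  toℕ-subMod-%n i j i≡j[n] =
    trans (toℕ-reduce-%n i (toℕ i + (N ∸ toℕ j))) (%-+∸ n n∣N (toℕ i) 0 (toℕ≤N j) i≡j[n])

  toℕ-subMod-self : ∀ (i : Fin N) → toℕ (subMod i i) ≡ 0
  toℕ-subMod-self i = trans (toℕ-reduce i (toℕ i + (N ∸ toℕ i))) (trans (cong (_% N) (m+[n∸m]≡n (toℕ≤N i))) (n%n≡0 N))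

  Central : G → Set
  Central (i , false) = toℕ i % n ≡ 0
  Central (_ , true)  = ⊥

  Central? : Decidable Central
  Central? (i , false) = toℕ i % n ℕ.≟ 0
  Central? (_ , true)  = no λ ()

  -- u and v lie in a common maximal cyclic subgroup: ⟨x⟩ or ⟨x^k y⟩ = {1, x^n, x^k y, x^(k+n) y}
  CoCyclic : G → G → Set
  CoCyclic (_ , false) (_ , false) = ⊤
  CoCyclic (i , false) (_ , true)  = toℕ i % n ≡ 0
  CoCyclic (_ , true)  (i , false) = toℕ i % n ≡ 0
  CoCyclic (k , true)  (l , true)  = toℕ k % n ≡ toℕ l % n

  CoCyclic? : ∀ u v → Dec (CoCyclic u v)
  CoCyclic? (_ , false) (_ , false) = yes tt
  CoCyclic? (i , false) (_ , true)  = toℕ i % n ℕ.≟ 0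
  CoCyclic? (_ , true)  (i , false) = toℕ i % n ℕ.≟ 0
  CoCyclic? (k , true)  (l , true)  = toℕ k % n ℕ.≟ toℕ l % n

  InX : G → Set
  InX (_ , b) = b ≡ false

  InX-· : ∀ {a b} → InX a → InX b → InX (a · b)
  InX-· {_ , false} {_ , false} refl refl = refl

  InX-⁻¹ : ∀ {a} → InX a → InX (a ⁻¹)
  InX-⁻¹ {_ , false} refl = refl

  InX-CoCyclic : ∀ {u v} → InX u → InX v → CoCyclic u v
  InX-CoCyclic {_ , false} {_ , false} refl refl = tt

  -- the subgroup ⟨x^c y⟩, for c < n
  InY : ℕ → G → Set
  InY c (i , false) = toℕ i % n ≡ 0
  InY c (k , true)  = toℕ k % n ≡ c

  InY-· : ∀ {c} → c % n ≡ c → ∀ {a b} → InY c a → InY c b → InY c (a · b)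
  InY-· _ {i , false} {j , false} i∈ j∈ =
    trans (toℕ-reduce-%n i (toℕ i + toℕ j)) (%-cong-+ n (toℕ i) 0 (toℕ j) 0 i∈ j∈)
  InY-· {c} c<n {i , false} {j , true} i∈ j∈ =
    trans (toℕ-reduce-%n i (toℕ i + toℕ j)) (trans (%-cong-+ n (toℕ i) 0 (toℕ j) c i∈ (trans j∈ (sym c<n))) c<n)
  InY-· _ {i , true} {j , false} i∈ j∈ =
    trans (toℕ-reduce-%n i (toℕ i + (N ∸ toℕ j))) (trans (%-+∸ n n∣N (toℕ i) (toℕ i) (toℕ≤N j) i≡i+j[n]) i∈)
    where
      i≡i+j[n] : toℕ i % n ≡ (toℕ i + toℕ j) % n
      i≡i+j[n] = sym (trans (%-cong-+ n (toℕ i) (toℕ i) (toℕ j) 0 refl j∈) (cong (_% n) (+-identityʳ (toℕ i))))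
  InY-· _ {i , true} {j , true} i∈ j∈ =
    trans (toℕ-reduce-%n (subMod i j) (toℕ (subMod i j) + n))
          (trans ([m+n]%n≡m%n (toℕ (subMod i j)) n) (toℕ-subMod-%n i j (trans i∈ (sym j∈))))

  InY-⁻¹ : ∀ {c a} → InY c a → InY c (a ⁻¹)
  InY-⁻¹ {a = i , false} i∈ =
    trans (toℕ-reduce-%n (subMod i i) (toℕ (subMod i i) + (N ∸ toℕ i)))
          (%-+∸ n n∣N (toℕ (subMod i i)) 0 (toℕ≤N i) (trans (toℕ-subMod-%n i i refl) (sym i∈)))
  InY-⁻¹ {a = k , true} k∈ = trans (toℕ-reduce-%n k (toℕ k + n)) (trans ([m+n]%n≡m%n (toℕ k) n) k∈)

  InY-CoCyclic : ∀ {c u v} → InY c u → InY c v → CoCyclic u v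
  InY-CoCyclic {u = _ , false} {_ , false} _  _  = tt
  InY-CoCyclic {u = _ , false} {_ , true}  u∈ _  = u∈
  InY-CoCyclic {u = _ , true}  {_ , false} _  v∈ = v∈
  InY-CoCyclic {u = _ , true}  {_ , true}  u∈ v∈ = trans u∈ (sym v∈)

  ⟨g⟩-CoCyclic : ∀ {g u v} → ⟨ g ∷ [] ⟩ u → ⟨ g ∷ [] ⟩ v → CoCyclic u v
  ⟨g⟩-CoCyclic {k , false} u∈ v∈ = InX-CoCyclic (⊆X u∈) (⊆X v∈)
    where
      ⊆X : ∀ {h} → ⟨ (k , false) ∷ [] ⟩ h → InX h
      ⊆X = Gen-closed InX InX-· InX-⁻¹ λ { (here refl) → refl }
  ⟨g⟩-CoCyclic {k , true} u∈ v∈ = InY-CoCyclic (⊆Y u∈) (⊆Y v∈)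
    where
      ⊆Y : ∀ {h} → ⟨ (k , true) ∷ [] ⟩ h → InY (toℕ k % n) h
      ⊆Y = Gen-closed (InY (toℕ k % n)) (InY-· (m%n%n≡m%n (toℕ k) n)) InY-⁻¹ λ { (here refl) → refl }

  adjacent⇒CoCyclic : ∀ {u v} → Adj u v → CoCyclic u v
  adjacent⇒CoCyclic (_ , _ , _ , ⟨u,v⟩⊆⟨g⟩) =
    ⟨g⟩-CoCyclic (⟨u,v⟩⊆⟨g⟩ _ (gen-base (here refl))) (⟨u,v⟩⊆⟨g⟩ _ (gen-base (there (here refl))))

  x^_ : ℕ → G
  x^ a = reduce fzero a , false

  toℕ-x^ : ∀ a → toℕ (proj₁ (x^ a)) ≡ a % N
  toℕ-x^ a = toℕ-reduce fzero a

  x^-cong : ∀ a b → a % N ≡ b % N → x^ a ≡ x^ b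
  x^-cong a b a≡b = ≡-on-index (trans (toℕ-x^ a) (trans a≡b (sym (toℕ-x^ b))))

  x^toℕ : ∀ (i : Fin N) → (i , false) ≡ x^ toℕ i
  x^toℕ i = ≡-on-index (sym (trans (toℕ-x^ (toℕ i)) (m<n⇒m%n≡m (Fin.toℕ<n i))))

  x^-· : ∀ a b → x^ a · x^ b ≡ x^ (a + b)
  x^-· a b = ≡-on-index (begin
      toℕ (reduce (proj₁ (x^ a)) (toℕ (proj₁ (x^ a)) + toℕ (proj₁ (x^ b))))
        ≡⟨ toℕ-reduce (proj₁ (x^ a)) (toℕ (proj₁ (x^ a)) + toℕ (proj₁ (x^ b))) ⟩
      (toℕ (proj₁ (x^ a)) + toℕ (proj₁ (x^ b))) % N ≡⟨ cong₂ (λ s t → (s + t) % N) (toℕ-x^ a) (toℕ-x^ b) ⟩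
      (a % N + b % N) % N                           ≡⟨ %-distribˡ-+ a b N ⟨
      (a + b) % N                                   ≡⟨ toℕ-x^ (a + b) ⟨
      toℕ (proj₁ (x^ (a + b)))                      ∎)
    where open ≡-Reasoning

  x^-⁻¹ : ∀ a → (x^ a) ⁻¹ ≡ x^ (N ∸ a % N)
  x^-⁻¹ a = ≡-on-index (begin
      toℕ (reduce (subMod r r) (toℕ (subMod r r) + (N ∸ toℕ r)))
        ≡⟨ toℕ-reduce (subMod r r) (toℕ (subMod r r) + (N ∸ toℕ r)) ⟩
      (toℕ (subMod r r) + (N ∸ toℕ r)) % N ≡⟨ cong₂ (λ s t → (s + (N ∸ t)) % N) (toℕ-subMod-self r) (toℕ-x^ a) ⟩
      (N ∸ a % N) % N                      ≡⟨ toℕ-x^ (N ∸ a % N) ⟨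
      toℕ (proj₁ (x^ (N ∸ a % N)))         ∎)
    where
      open ≡-Reasoning
      r = proj₁ (x^ a)

  x^-difference : ∀ {gs} d a b → d + a ≡ b → ⟨ gs ⟩ (x^ b) → ⟨ gs ⟩ (x^ a) → ⟨ gs ⟩ (x^ d)
  x^-difference {gs} d a b d+a≡b x^b∈ x^a∈ = subst ⟨ gs ⟩ x^b·x^-a≡x^d (gen-mul x^b∈ (gen-inv x^a∈))
    where
      b≡d+a[N] : b % N ≡ (d + a % N) % N
      b≡d+a[N] = trans (cong (_% N) (sym d+a≡b)) (%-cong-+ N d d a (a % N) refl (sym (m%n%n≡m%n a N)))
      x^b·x^-a≡x^d : x^ b · (x^ a) ⁻¹ ≡ x^ d
      x^b·x^-a≡x^d = begin
        x^ b · (x^ a) ⁻¹        ≡⟨ cong (x^ b ·_) (x^-⁻¹ a) ⟩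
        x^ b · x^ (N ∸ a % N)   ≡⟨ x^-· b (N ∸ a % N) ⟩
        x^ (b + (N ∸ a % N))    ≡⟨ x^-cong (b + (N ∸ a % N)) d (%-+∸ N ∣-refl b d (<⇒≤ (m%n<n a N)) b≡d+a[N]) ⟩
        x^ d                    ∎
        where open ≡-Reasoning

  x^-multiple : ∀ {gs} a → ⟨ gs ⟩ (x^ a) → ∀ k → ⟨ gs ⟩ (x^ (k * a))
  x^-multiple a x^a∈ zero    = x^-difference 0 a a refl x^a∈ x^a∈
  x^-multiple a x^a∈ (suc k) = subst ⟨ _ ⟩ (x^-· a (k * a)) (gen-mul x^a∈ (x^-multiple a x^a∈ k))

  -- ⟨x^a, x^b⟩ = ⟨x^gcd(a,b)⟩, by Bézout
  x-powers-cyclic : ∀ (i j : Fin N) → CyclicPair _·_ _⁻¹ (i , false) (j , false)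
  x-powers-cyclic i j = cyclicPair-intro x^d∈⟨a,b⟩ (divisor-power (x^toℕ i) (gcd[m,n]∣m a b))
                                                   (divisor-power (x^toℕ j) (gcd[m,n]∣n a b))
    where
      a = toℕ i
      b = toℕ j
      d = gcd a b
      gs = (i , false) ∷ (j , false) ∷ []
      x^a∈ : ⟨ gs ⟩ (x^ a)
      x^a∈ = subst ⟨ gs ⟩ (x^toℕ i) (gen-base (here refl))
      x^b∈ : ⟨ gs ⟩ (x^ b)
      x^b∈ = subst ⟨ gs ⟩ (x^toℕ j) (gen-base (there (here refl)))
      x^d∈⟨a,b⟩ : ⟨ gs ⟩ (x^ d)
      x^d∈⟨a,b⟩ with Bézout.identity (gcd-GCD a b)
      ... | Bézout.+- s t d+tb≡sa = x^-difference d (t * b) (s * a) d+tb≡sa (x^-multiple a x^a∈ s) (x^-multiple b x^b∈ t)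
      ... | Bézout.-+ s t d+sa≡tb = x^-difference d (s * a) (t * b) d+sa≡tb (x^-multiple b x^b∈ t) (x^-multiple a x^a∈ s)
      divisor-power : ∀ {h c} → h ≡ x^ c → d ∣ c → ⟨ x^ d ∷ [] ⟩ h
      divisor-power {c = c} refl (divides q c≡qd) =
        subst (⟨ x^ d ∷ [] ⟩ ∘ x^_) (sym c≡qd) (x^-multiple d (gen-base (here refl)) q)

  y²≡x^n : ∀ k → (k , true) · (k , true) ≡ x^ n
  y²≡x^n k = ≡-on-index (begin
      toℕ (reduce (subMod k k) (toℕ (subMod k k) + n))
        ≡⟨ toℕ-reduce (subMod k k) (toℕ (subMod k k) + n) ⟩
      (toℕ (subMod k k) + n) % N ≡⟨ cong (λ t → (t + n) % N) (toℕ-subMod-self k) ⟩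
      n % N                      ≡⟨ toℕ-x^ n ⟨
      toℕ (proj₁ (x^ n))         ∎)
    where open ≡-Reasoning

  x^n∈⟨y⟩ : ∀ k → ⟨ (k , true) ∷ [] ⟩ (x^ n)
  x^n∈⟨y⟩ k = subst ⟨ _ ⟩ (y²≡x^n k) (gen-mul (gen-base (here refl)) (gen-base (here refl)))

  central-∈⟨y⟩ : ∀ i k → toℕ i % n ≡ 0 → ⟨ (k , true) ∷ [] ⟩ (i , false)
  central-∈⟨y⟩ i k i≡0[n] = subst ⟨ _ ⟩ (sym (x^toℕ i)) (x^i∈ (<N⇒≡%n⊎≡%n+n (Fin.toℕ<n i)))
    where
      x^i∈ : toℕ i ≡ toℕ i % n ⊎ toℕ i ≡ toℕ i % n + n → ⟨ (k , true) ∷ [] ⟩ (x^ toℕ i)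
      x^i∈ (inj₁ i≡0) = subst ⟨ _ ⟩ (trans (x^-· n n) (x^-cong (n + n) (toℕ i) n+n≡i[N]))
                                     (gen-mul (x^n∈⟨y⟩ k) (x^n∈⟨y⟩ k))
        where
          n+n≡i[N] : (n + n) % N ≡ toℕ i % N
          n+n≡i[N] = trans (cong (_% N) (sym N≡n+n))
                           (trans (n%n≡0 N) (cong (_% N) (sym (trans i≡0 i≡0[n]))))
      x^i∈ (inj₂ i≡n) = subst ⟨ _ ⟩ (x^-cong n (toℕ i) (cong (_% N) (sym (trans i≡n (cong (_+ n) i≡0[n])))))
                                     (x^n∈⟨y⟩ k)

  -- x^k y and x^(k+n) y are mutually inverse
  y-pair-cyclic : ∀ k l → toℕ k % n ≡ toℕ l % n → (k , true) ≢ (l , true) →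
                  CyclicPair _·_ _⁻¹ (k , true) (l , true)
  y-pair-cyclic k l k≡l[n] k≢l = cyclicPair-intro (gen-base (here refl)) (gen-base (here refl))
    (subst ⟨ _ ⟩ (≡-on-index (trans (toℕ-reduce k (toℕ k + n)) l≡k+n)) (gen-inv (gen-base (here refl))))
    where
      l≡k+n : (toℕ k + n) % N ≡ toℕ l
      l≡k+n = +n%N≡other-lift (Fin.toℕ<n k) (Fin.toℕ<n l) k≡l[n] (k≢l ∘ ≡-on-index)

  CoCyclic⇒adjacent : ∀ {u v} → u ≢ v → CoCyclic u v → Adj u v
  CoCyclic⇒adjacent {i , false} {j , false} u≢v _ = u≢v , x-powers-cyclic i j
  CoCyclic⇒adjacent {i , false} {k , true} _ i≡0[n] =
    (λ ()) , cyclicPair-intro (gen-base (there (here refl))) (central-∈⟨y⟩ i k i≡0[n]) (gen-base (here refl))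
  CoCyclic⇒adjacent {_ , true} {_ , false} u≢v i≡0[n] = EPGAdj-sym (CoCyclic⇒adjacent (u≢v ∘ sym) i≡0[n])
  CoCyclic⇒adjacent {k , true} {l , true} u≢v k≡l[n] = u≢v , y-pair-cyclic k l k≡l[n] u≢v

  open StrongResolution Adj _≟_

  Adj? : ∀ u v → Dec (Adj u v)
  Adj? u v with u ≟ v
  ... | yes refl = no λ u~u → proj₁ u~u refl
  ... | no u≢v   = map′ (CoCyclic⇒adjacent u≢v) adjacent⇒CoCyclic (CoCyclic? u v)

  central-universal : ∀ {t} → Central t → Universal t
  central-universal {_ , false} _         (_ , false) z≢t = CoCyclic⇒adjacent z≢t tt
  central-universal {_ , false} t-central (_ , true)  z≢t = CoCyclic⇒adjacent z≢t t-central

  CoCyclic-trans : ∀ a {v} b → ¬ Central v → CoCyclic a v → CoCyclic v b → CoCyclic a b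
  CoCyclic-trans (_ , false) {_ , false} (_ , false) _ _ _ = tt
  CoCyclic-trans (_ , true)  {_ , false} _           v∉Z a~v _ = ⊥-elim (v∉Z a~v)
  CoCyclic-trans (_ , false) {_ , false} (_ , true)  v∉Z _ v~b = ⊥-elim (v∉Z v~b)
  CoCyclic-trans (_ , false) {_ , true}  (_ , false) _ _ _ = tt
  CoCyclic-trans (_ , false) {_ , true}  (_ , true)  _ a~v _ = a~v
  CoCyclic-trans (_ , true)  {_ , true}  (_ , false) _ _ v~b = v~b
  CoCyclic-trans (_ , true)  {_ , true}  (_ , true)  _ a~v v~b = trans a~v v~b

  noncentral-simplicial : ∀ {v} → ¬ Central v → Simplicial v
  noncentral-simplicial v∉Z {a} {b} a~v v~b a≢b =
    CoCyclic⇒adjacent a≢b (CoCyclic-trans a b v∉Z (adjacent⇒CoCyclic a~v) (adjacent⇒CoCyclic v~b))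

  shortest : ∀ {u v} → u ≢ v → Shortest u v
  shortest = shortest-via-universal Adj? EPGAdj-sym (central-universal {fzero , false} refl)

  layers : List (Fin N) → List G
  layers is = map (_, false) is ++ map (_, true) is

  layers-unique : ∀ {is} → Unique is → Unique (layers is)
  layers-unique is! = ++⁺ (map⁺ (cong proj₁) is!) (map⁺ (cong proj₁) is!) disjoint
    where
      disjoint : ∀ {v} → ¬ (v ∈ map (_, false) _ × v ∈ map (_, true) _)
      disjoint (v∈ , v∈′) with ∈-map⁻ (_, false) v∈ | ∈-map⁻ (_, true) v∈′
      ... | _ , _ , refl | _ , _ , ()

  length-layers : ∀ is → length (layers is) ≡ length is + length is
  length-layers is = trans (length-++ (map (_, false) is))
                           (cong₂ _+_ (length-map (_, false) is) (length-map (_, true) is))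

  ∈-layers : ∀ {i is} b → i ∈ is → (i , b) ∈ layers is
  ∈-layers false i∈ = ∈-++⁺ˡ (∈-map⁺ (_, false) i∈)
  ∈-layers {is = is} true  i∈ = ∈-++⁺ʳ (map (_, false) is) (∈-map⁺ (_, true) i∈)

  nonzero-indices : List (Fin N)
  nonzero-indices = map fsuc (allFin (ℕ.pred N))

  -- every element except 1 = (0 , false) and y = (0 , true)
  S₀ : List G
  S₀ = layers nonzero-indices

  S₀-unique : Unique S₀
  S₀-unique = layers-unique (map⁺ Fin.suc-injective (allFin⁺ (ℕ.pred N)))

  length-S₀ : length S₀ ≡ 4 * n ∸ 2
  length-S₀ = begin
      length S₀                                           ≡⟨ length-layers nonzero-indices ⟩
      length nonzero-indices + length nonzero-indices     ≡⟨ cong (λ l → l + l) length-nonzero-indices ⟩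
      ℕ.pred N + ℕ.pred N                                 ≡⟨ cong (_∸ 2) (4n≡2+[N-1+N-1] m) ⟨
      4 * n ∸ 2                                           ∎
    where
      open ≡-Reasoning
      length-nonzero-indices : length nonzero-indices ≡ ℕ.pred N
      length-nonzero-indices = trans (length-map fsuc (allFin (ℕ.pred N))) (length-tabulate {n = ℕ.pred N} (λ i → i))
      4n≡2+[N-1+N-1] : ∀ k → 4 * suc k ≡ 2 + (k + 1 * suc k + (k + 1 * suc k))
      4n≡2+[N-1+N-1] = solve-∀

  S₀-covers : ∀ v → v ∈ S₀ ⊎ v ≡ (fzero , false) ⊎ v ≡ (fzero , true)
  S₀-covers (fzero , false) = inj₂ (inj₁ refl)
  S₀-covers (fzero , true)  = inj₂ (inj₂ refl)
  S₀-covers (fsuc i , b)    = inj₁ (∈-layers b (∈-map⁺ fsuc (∈-allFin i)))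

  module _ (1<n : 1 < n) where

    toℕ-x¹ : toℕ (proj₁ (x^ 1)) ≡ 1
    toℕ-x¹ = trans (toℕ-x^ 1) (m<n⇒m%n≡m (<-trans 1<n n<N))

    x¹≢1 : x^ 1 ≢ (fzero , false)
    x¹≢1 x¹≡1 with () ← trans (sym toℕ-x¹) (cong (toℕ ∘ proj₁) x¹≡1)

    x¹∈S₀ : x^ 1 ∈ S₀
    x¹∈S₀ with S₀-covers (x^ 1)
    ... | inj₁ x¹∈S₀       = x¹∈S₀
    ... | inj₂ (inj₁ x¹≡1) = ⊥-elim (x¹≢1 x¹≡1)
    ... | inj₂ (inj₂ ())

    x¹≁y : ¬ Adj (x^ 1) (fzero , true)
    x¹≁y x¹~y with () ← trans (sym (trans (cong (_% n) toℕ-x¹) (m<n⇒m%n≡m 1<n))) (adjacent⇒CoCyclic x¹~y)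

    x¹-resolves-1,y : StronglyResolves Adj (x^ 1) (fzero , false) (fzero , true)
    x¹-resolves-1,y = inj₂ (two-step-shortest (λ ()) x¹≁y (central-universal refl (x^ 1) x¹≢1)
                                                       (CoCyclic⇒adjacent (λ ()) refl))

    S₀-resolving : StrongResolvingSet Adj S₀
    S₀-resolving = all-but-two-resolving shortest S₀-covers x¹∈S₀ x¹-resolves-1,y

  resolving-set-length≥4n∸2 : ∀ S → StrongResolvingSet Adj S → 4 * n ∸ 2 ≤ length S
  resolving-set-length≥4n∸2 S S-resolving = begin
      4 * n ∸ 2                       ≡⟨ cong (_∸ 2) length-G ⟨
      length (layers (allFin N)) ∸ 2  ≤⟨ ∸-monoˡ-≤ 2 (resolving-set-misses-≤2 Central? central-universal
                                           noncentral-simplicial S-resolving (layers-unique (allFin⁺ N))) ⟩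
      length S + 2 ∸ 2                ≡⟨ m+n∸n≡m (length S) 2 ⟩
      length S                        ∎
    where
      open ≤-Reasoning
      length-G : length (layers (allFin N)) ≡ 4 * n
      length-G = trans (length-layers (allFin N))
                       (trans (cong (λ l → l + l) (length-tabulate {n = N} (λ i → i))) (sym (*-distribʳ-+ n 2 2)))

  sdim : 1 < n → SDimIs Adj (4 * n ∸ 2)
  sdim 1<n = (S₀ , S₀-unique , length-S₀ , S₀-resolving 1<n) , λ S _ → resolving-set-length≥4n∸2 S

corollary4p7 : (n : ℕ) → 2 ≤ n → SDimIs (EPGAdj (mulQ n) (invQ n)) (4 * n ∸ 2)
corollary4p7 (suc m) 2≤n = QuaternionGraph.sdim m 2≤n
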